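{- Let $\mathbb{P}$ denote the set of prime numbers. For every non-negative integer $n$, $g(n) \in \mathbb{N}_{\geq 0} \setminus \mathbb{P}$; that is, $g(n)$ is not prime.
   Context: For a non-negative integer $n$, $g(n)$ is the least integer $k$ such that there exists a strictly increasing sequence of integers $n = a_1 < a_2 < \cdots < a_t = k$ ($t \geq 1$) whose product $a_1 a_2 \cdots a_t$ is a perfect square. -}

module Defs where

open import Data.Nat using (ℕ; _*_; _<_; _≤_)
open import Data.List using (List; []; _∷_; last)
open import Data.Nat.ListAction using (product)
open import Data.List.Relation.Unary.Linked using (Linked)
open import Data.Maybe using (just)
open import Data.Product using (Σ; ∃; _×_)
open import Relation.Binary.PropositionalEquality using (_≡_)

IsSquare : ℕ → Set
IsSquare m = ∃ λ r → m ≡ r * r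

Admissible : ℕ → ℕ → Set
Admissible n k =
  Σ (List ℕ) λ rest →
    Linked _<_ (n ∷ rest) × last (n ∷ rest) ≡ just k × IsSquare (product (n ∷ rest))

-- IsG n k : k = g(n), the least k for which an admissible sequence exists.
IsG : ℕ → ℕ → Set
IsG n k = Admissible n k × (∀ m → Admissible n m → k ≤ m)

module Submission where

-- g(0) = 0, witnessed by the one-term sequence 0. For n ≥ 1, let n = a₁ < ⋯ < aₜ = p with p prime
-- and a₁ ⋯ aₜ = r². Then p ∣ r², so p ∣ r and p² ∣ a₁ ⋯ aₜ, i.e. p ∣ a₁ ⋯ aₜ₋₁. But every aᵢ with
-- i < t lies in [1, p), so p divides none of them, contradicting Euclid's lemma. Thus minimality
-- matters only for n = 0: from n ≥ 1, no admissible sequence ends at a prime at all.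

open import Defs
open import Data.Nat using (ℕ)
open import Data.Nat.Primality using (Prime)
open import Relation.Nullary using (¬_)

open import Data.Nat using (zero; suc; _*_; _<_; _≤_; z≤n; s≤s; >-nonZero)
open import Data.Nat.Properties using (≤-refl; ≤-trans; <⇒≤; <-≤-trans; *-identityˡ; *-identityʳ; *-assoc; n≤0⇒n≡0)
open import Data.Nat.Divisibility using (_∣_; _∤_; divides; >⇒∤; ∣1⇒≡1; *-pres-∣; *-cancelʳ-∣)
open import Data.Nat.Primality using (euclidsLemma; prime⇒nonZero; ¬prime[0]; ¬prime[1])
open import Data.Nat.ListAction using (product)
open import Data.List using (List; []; _∷_; last)
open import Data.List.Relation.Unary.Linked using (Linked; [-]; _∷_)
open import Data.List.Relation.Unary.All as All using (All; []; _∷_)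
open import Data.Maybe using (just)
open import Data.Product using (Σ; _×_; _,_; map₁)
open import Data.Sum using ([_,_]′)
open import Function using (id)
open import Relation.Binary.PropositionalEquality using (_≡_; refl; sym; trans; cong; subst)

product≡init*last : ∀ {x k} xs → Linked _<_ (x ∷ xs) → last (x ∷ xs) ≡ just k →
                    Σ (List ℕ) λ ys →
                      product (x ∷ xs) ≡ product ys * k × All (λ y → x ≤ y × y < k) ys × x ≤ k
product≡init*last {x} [] _ refl = [] , trans (*-identityʳ x) (sym (*-identityˡ x)) , [] , ≤-refl
product≡init*last {x} (y ∷ xs) (x<y ∷ linked) last≡k
  with product≡init*last xs linked last≡k
... | ys , ∏≡ , bounds , y≤k =
  x ∷ ys ,
  trans (cong (x *_) ∏≡) (sym (*-assoc x (product ys) _)) ,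
  (≤-refl , <-≤-trans x<y y≤k) ∷ All.map (map₁ (≤-trans (<⇒≤ x<y))) bounds ,
  ≤-trans (<⇒≤ x<y) y≤k

prime∤product : ∀ {p ys} → Prime p → All (λ y → 0 < y × y < p) ys → p ∤ product ys
prime∤product pp []                     p∣1 = ¬prime[1] (subst Prime (∣1⇒≡1 p∣1) pp)
prime∤product {ys = y ∷ _} pp ((0<y , y<p) ∷ bounds) p∣∏ =
  [ >⇒∤ {{>-nonZero 0<y}} y<p , prime∤product pp bounds ]′ (euclidsLemma y _ pp p∣∏)

*-prime≡square⇒∣ : ∀ {m p r} → Prime p → m * p ≡ r * r → p ∣ m
*-prime≡square⇒∣ {m} {p} {r} pp mp≡rr = *-cancelʳ-∣ p {{prime⇒nonZero pp}} p*p∣m*p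
  where
  p∣r : p ∣ r
  p∣r = [ id , id ]′ (euclidsLemma r r pp (divides m (sym mp≡rr)))

  p*p∣m*p : p * p ∣ m * p
  p*p∣m*p = subst (p * p ∣_) (sym mp≡rr) (*-pres-∣ p∣r p∣r)

g[0]≡0 : ∀ {k} → IsG 0 k → k ≡ 0
g[0]≡0 (_ , least) = n≤0⇒n≡0 (least 0 ([] , [-] , refl , 0 , refl))

lemma1p9 : (n k : ℕ) → IsG n k → ¬ Prime k
lemma1p9 zero    k isG pk = ¬prime[0] (subst Prime (g[0]≡0 isG) pk)
lemma1p9 (suc n) k ((rest , increasing , ends-in-k , r , ∏≡r²) , _) pk
  with product≡init*last rest increasing ends-in-k
... | ys , ∏≡ys*k , bounds , _ =
  prime∤product pk (All.map (map₁ (≤-trans (s≤s z≤n))) bounds)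
                   (*-prime≡square⇒∣ {r = r} pk (trans (sym ∏≡ys*k) ∏≡r²))
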